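{- Let $G$ be a finite nonabelian simple group, $x\in G$ an involution, $\alpha=\sigma_x$, and $n$ a divisor of $|G|$. If $\Delta_\alpha$ acts transitively on $\Omega^*_x(G,n)$, then the elements of order $n$ of $G$ lie in at most two $\mathrm{Aut}(G)$-orbits (fusion classes).
   Context: $\sigma_x$ is conjugation $y\mapsto xyx$. $\mathrm{Aut}(G)_\alpha=\{\gamma\in\mathrm{Aut}(G):\gamma\alpha=\alpha\gamma\}$ and $\Delta_\alpha=\mathrm{Inn}(G)\,\mathrm{Aut}(G)_\alpha$. Define $\Omega_x(G,n)=\{\{xg,g^{ -1}x^{ -1}\}: g\in G,\ o(xg)=n\}$ (equivalently, the set of all unordered pairs $\{h,h^{ -1}\}$ with $h\in G$ of order $n$), and $\Omega^*_x(G,n)=\Omega_x(G,n)$ for $n\neq 2$, while $\Omega^*_x(G,2)$ is $\Omega_x(G,2)$ with the singletons $\{hxh^{ -1}\}$ ($h\in G$), i.e. the conjugacy class of $x$, removed. $\Delta_\alpha$ acts on these sets by $\delta\cdot\{h,h^{ -1}\}=\{\delta(h),\delta(h)^{ -1}\}$; an action on the empty set counts as transitive. -}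

module Defs where

open import Data.Nat using (ℕ; zero; suc; _<_)
open import Data.Fin using (Fin)
open import Data.Bool using (Bool; true)
open import Data.Product using (Σ; ∃; _×_; _,_)
open import Data.Sum using (_⊎_)
open import Relation.Nullary using (¬_)
open import Relation.Binary.PropositionalEquality using (_≡_; _≢_)

-- A finite group, given concretely on the carrier Fin order
-- (every finite group is isomorphic to such a one).
record FinGroup : Set where
  field
    order : ℕ
    _∙_   : Fin order → Fin order → Fin order
    e     : Fin order
    inv   : Fin order → Fin order
    assoc : ∀ a b c → (a ∙ b) ∙ c ≡ a ∙ (b ∙ c)
    idˡ   : ∀ a → e ∙ a ≡ a
    idʳ   : ∀ a → a ∙ e ≡ a
    invˡ  : ∀ a → inv a ∙ a ≡ e
    invʳ  : ∀ a → a ∙ inv a ≡ e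
  infixl 7 _∙_

module _ (G : FinGroup) where
  open FinGroup G

  Elt : Set
  Elt = Fin order

  pow : Elt → ℕ → Elt
  pow g zero    = e
  pow g (suc k) = g ∙ pow g k

  HasOrder : Elt → ℕ → Set
  HasOrder g n = (0 < n) × (pow g n ≡ e) × (∀ k → 0 < k → k < n → pow g k ≢ e)

  IsInvolution : Elt → Set
  IsInvolution x = HasOrder x 2

  Nonabelian : Set
  Nonabelian = Σ Elt λ a → Σ Elt λ b → a ∙ b ≢ b ∙ a

  IsNormalSubgroup : (Elt → Bool) → Set
  IsNormalSubgroup H =
    (H e ≡ true) ×
    (∀ a b → H a ≡ true → H b ≡ true → H (a ∙ b) ≡ true) ×
    (∀ a → H a ≡ true → H (inv a) ≡ true) ×
    (∀ g a → H a ≡ true → H (g ∙ a ∙ inv g) ≡ true)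

  IsSimple : Set
  IsSimple =
    (Σ Elt λ g → g ≢ e) ×
    (∀ H → IsNormalSubgroup H → (∀ a → H a ≡ true → a ≡ e) ⊎ (∀ a → H a ≡ true))

  record Aut : Set where
    field
      fun   : Elt → Elt
      funInv : Elt → Elt
      left  : ∀ a → funInv (fun a) ≡ a
      right : ∀ a → fun (funInv a) ≡ a
      hom   : ∀ a b → fun (a ∙ b) ≡ fun a ∙ fun b

  σ : Elt → Elt → Elt
  σ h y = h ∙ y ∙ inv h

  Conjugate : Elt → Elt → Set
  Conjugate a b = Σ Elt λ h → σ h b ≡ a

  -- γ ∈ Aut(G)_α : γ commutes with α
  Commutes : Aut → (Elt → Elt) → Set
  Commutes γ α = ∀ y → Aut.fun γ (α y) ≡ α (Aut.fun γ y)

  -- Δ_α = Inn(G) Aut(G)_α : maps of the form σ_h ∘ γ with γ ∈ Aut(G)_α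
  InΔ : (Elt → Elt) → (Elt → Elt) → Set
  InΔ α δ = Σ Elt λ h → Σ Aut λ γ → Commutes γ α × (∀ y → δ y ≡ σ h (Aut.fun γ y))

  -- h represents an element {h, h⁻¹} of Ω*_x(G,n)
  InΩ* : Elt → ℕ → Elt → Set
  InΩ* x n h = HasOrder h n × (n ≡ 2 → ¬ Conjugate h x)

  -- Δ_α acts transitively on Ω*_x(G,n)
  -- (δ·{a,a⁻¹} = {b,b⁻¹} iff δ a = b or δ a = b⁻¹)
  TransitiveΩ* : Elt → ℕ → Set
  TransitiveΩ* x n = ∀ a b → InΩ* x n a → InΩ* x n b →
    Σ (Elt → Elt) λ δ → InΔ (σ x) δ × ((δ a ≡ b) ⊎ (δ a ≡ inv b))

  AutRelated : Elt → Elt → Set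
  AutRelated a b = Σ Aut λ φ → Aut.fun φ a ≡ b

  -- elements of order n lie in at most two Aut(G)-orbits:
  -- among any three of them, two are in the same orbit
  AtMostTwoAutOrbits : ℕ → Set
  AtMostTwoAutOrbits n = ∀ a b c → HasOrder a n → HasOrder b n → HasOrder c n →
    AutRelated a b ⊎ AutRelated a c ⊎ AutRelated b c

module Submission where

-- Every element δ = σ_h ∘ γ of Δ_α is itself an automorphism
-- of G, so transitivity of Δ_α on Ω*_x(G,n) says that for any two
-- representatives a, b of Ω*_x(G,n) some automorphism maps {a,a⁻¹} onto
-- {b,b⁻¹}; hence b lies in the Aut(G)-orbit of a or of a⁻¹.
-- The theorem is then a pigeonhole argument: the elements of order n are
-- covered by two classes, each lying inside a single Aut(G)-orbit, so two
-- of any three such elements are Aut(G)-related.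
--   * n ≠ 2: Ω*_x(G,n) contains all elements of order n; the classes are
--     the orbits of a and of a⁻¹.
--   * n = 2: the classes are the conjugacy class of x (one orbit, via inner
--     automorphisms) and the remaining involutions, which form Ω*_x(G,2);
--     an involution b equals b⁻¹, so "related to a or to a⁻¹" collapses.

open import Defs
open import Level using (0ℓ)
open import Algebra.Bundles using (Group)
import Algebra.Properties.Group as GroupProperties
open import Data.Nat using (ℕ)
import Data.Nat as ℕ
open import Data.Nat.Divisibility using (_∣_)
import Data.Fin.Properties as FinP
open import Data.Product using (Σ; _,_; proj₁)
open import Data.Sum using (_⊎_; inj₁; inj₂)
open import Data.Empty using (⊥-elim)
open import Relation.Nullary using (Dec; yes; no)
open import Relation.Binary.PropositionalEquality

pigeonhole : {A : Set} (R : A → A → Set) (P Q : A → Set) →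
  (∀ {u v} → P u → P v → R u v) → (∀ {u v} → Q u → Q v → R u v) →
  ∀ {a b c} → P a ⊎ Q a → P b ⊎ Q b → P c ⊎ Q c → R a b ⊎ R a c ⊎ R b c
pigeonhole R P Q inP inQ (inj₁ pa) (inj₁ pb) _         = inj₁ (inP pa pb)
pigeonhole R P Q inP inQ (inj₂ qa) (inj₂ qb) _         = inj₁ (inQ qa qb)
pigeonhole R P Q inP inQ (inj₁ pa) (inj₂ _)  (inj₁ pc) = inj₂ (inj₁ (inP pa pc))
pigeonhole R P Q inP inQ (inj₁ _)  (inj₂ qb) (inj₂ qc) = inj₂ (inj₂ (inQ qb qc))
pigeonhole R P Q inP inQ (inj₂ qa) (inj₁ _)  (inj₂ qc) = inj₂ (inj₁ (inQ qa qc))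
pigeonhole R P Q inP inQ (inj₂ _)  (inj₁ pb) (inj₁ pc) = inj₂ (inj₂ (inP pb pc))

module _ (G : FinGroup) where
  open FinGroup G
  open ≡-Reasoning

  -- The group laws of G, packaged as a library Group so that its derived
  -- properties (uniqueness of inverses, ...) can be reused.
  asGroup : Group 0ℓ 0ℓ
  asGroup = record
    { isGroup = record
      { isMonoid = record
        { isSemigroup = record
          { isMagma = record { isEquivalence = isEquivalence ; ∙-cong = cong₂ _∙_ }
          ; assoc = assoc }
        ; identity = idˡ , idʳ }
      ; inverse = invˡ , invʳ
      ; ⁻¹-cong = cong inv } }

  open GroupProperties asGroup
    using (inverseˡ-unique; ⁻¹-involutive; ⁻¹-anti-homo-∙; identityˡ-unique)

  σ-identity : ∀ a → σ G e a ≡ a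
  σ-identity a = begin
    e ∙ a ∙ inv e ≡⟨ cong (λ z → e ∙ a ∙ z) (sym (inverseˡ-unique e e (idˡ e))) ⟩
    e ∙ a ∙ e     ≡⟨ idʳ (e ∙ a) ⟩
    e ∙ a         ≡⟨ idˡ a ⟩
    a             ∎

  σ-compose : ∀ g h a → σ G g (σ G h a) ≡ σ G (g ∙ h) a
  σ-compose g h a = begin
    g ∙ (h ∙ a ∙ inv h) ∙ inv g   ≡⟨ cong (_∙ inv g) (sym (assoc g (h ∙ a) (inv h))) ⟩
    g ∙ (h ∙ a) ∙ inv h ∙ inv g   ≡⟨ assoc (g ∙ (h ∙ a)) (inv h) (inv g) ⟩
    g ∙ (h ∙ a) ∙ (inv h ∙ inv g) ≡⟨ cong₂ _∙_ (sym (assoc g h a)) (sym (⁻¹-anti-homo-∙ g h)) ⟩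
    g ∙ h ∙ a ∙ inv (g ∙ h)       ∎

  σ-hom : ∀ h a b → σ G h (a ∙ b) ≡ σ G h a ∙ σ G h b
  σ-hom h a b = sym (begin
    h ∙ a ∙ inv h ∙ (h ∙ b ∙ inv h)     ≡⟨ assoc (h ∙ a) (inv h) (h ∙ b ∙ inv h) ⟩
    h ∙ a ∙ (inv h ∙ (h ∙ b ∙ inv h))   ≡⟨ cong (h ∙ a ∙_) (sym (assoc (inv h) (h ∙ b) (inv h))) ⟩
    h ∙ a ∙ (inv h ∙ (h ∙ b) ∙ inv h)   ≡⟨ cong (λ z → h ∙ a ∙ (z ∙ inv h)) (sym (assoc (inv h) h b)) ⟩
    h ∙ a ∙ (inv h ∙ h ∙ b ∙ inv h)     ≡⟨ cong (λ z → h ∙ a ∙ (z ∙ b ∙ inv h)) (invˡ h) ⟩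
    h ∙ a ∙ (e ∙ b ∙ inv h)             ≡⟨ cong (λ z → h ∙ a ∙ (z ∙ inv h)) (idˡ b) ⟩
    h ∙ a ∙ (b ∙ inv h)                 ≡⟨ sym (assoc (h ∙ a) b (inv h)) ⟩
    h ∙ a ∙ b ∙ inv h                   ≡⟨ cong (_∙ inv h) (assoc h a b) ⟩
    h ∙ (a ∙ b) ∙ inv h                 ∎)

  σ-cancel : ∀ g h → g ∙ h ≡ e → ∀ a → σ G g (σ G h a) ≡ a
  σ-cancel g h gh≡e a = begin
    σ G g (σ G h a) ≡⟨ σ-compose g h a ⟩
    σ G (g ∙ h) a   ≡⟨ cong (λ z → σ G z a) gh≡e ⟩
    σ G e a         ≡⟨ σ-identity a ⟩
    a               ∎

  _∘Aut_ : Aut G → Aut G → Aut G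
  φ ∘Aut ψ = record
    { fun    = λ y → Aut.fun φ (Aut.fun ψ y)
    ; funInv = λ y → Aut.funInv ψ (Aut.funInv φ y)
    ; left   = λ a → trans (cong (Aut.funInv ψ) (Aut.left φ _)) (Aut.left ψ a)
    ; right  = λ a → trans (cong (Aut.fun φ) (Aut.right ψ _)) (Aut.right φ a)
    ; hom    = λ a b → trans (cong (Aut.fun φ) (Aut.hom ψ a b)) (Aut.hom φ _ _) }

  funInv-hom : (φ : Aut G) → ∀ a b →
    Aut.funInv φ (a ∙ b) ≡ Aut.funInv φ a ∙ Aut.funInv φ b
  funInv-hom φ a b = begin
    g (a ∙ b)             ≡⟨ cong g (cong₂ _∙_ (Aut.right φ a) (Aut.right φ b)) ⟨
    g (f (g a) ∙ f (g b)) ≡⟨ cong g (Aut.hom φ (g a) (g b)) ⟨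
    g (f (g a ∙ g b))     ≡⟨ Aut.left φ _ ⟩
    g a ∙ g b             ∎
    where
      f g : Elt G → Elt G
      f = Aut.fun φ
      g = Aut.funInv φ

  _⁻¹Aut : Aut G → Aut G
  φ ⁻¹Aut = record
    { fun = Aut.funInv φ ; funInv = Aut.fun φ
    ; left = Aut.right φ ; right = Aut.left φ ; hom = funInv-hom φ }

  inner : Elt G → Aut G
  inner h = record
    { fun    = σ G h
    ; funInv = σ G (inv h)
    ; left   = σ-cancel (inv h) h (invˡ h)
    ; right  = σ-cancel h (inv h) (invʳ h)
    ; hom    = σ-hom h }

  aut-e : (φ : Aut G) → Aut.fun φ e ≡ e
  aut-e φ = identityˡ-unique (Aut.fun φ e) (Aut.fun φ e)
    (trans (sym (Aut.hom φ e e)) (cong (Aut.fun φ) (idˡ e)))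

  aut-inv : (φ : Aut G) → ∀ a → Aut.fun φ (inv a) ≡ inv (Aut.fun φ a)
  aut-inv φ a = inverseˡ-unique _ _ (begin
    Aut.fun φ (inv a) ∙ Aut.fun φ a ≡⟨ Aut.hom φ (inv a) a ⟨
    Aut.fun φ (inv a ∙ a)           ≡⟨ cong (Aut.fun φ) (invˡ a) ⟩
    Aut.fun φ e                     ≡⟨ aut-e φ ⟩
    e                               ∎)

  autRelated-sym : ∀ {a b} → AutRelated G a b → AutRelated G b a
  autRelated-sym {a} (φ , φa≡b) = φ ⁻¹Aut , trans (cong (Aut.funInv φ) (sym φa≡b)) (Aut.left φ a)

  autRelated-trans : ∀ {a b c} → AutRelated G a b → AutRelated G b c → AutRelated G a c
  autRelated-trans (φ , φa≡b) (ψ , ψb≡c) = ψ ∘Aut φ , trans (cong (Aut.fun ψ) φa≡b) ψb≡c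

  sameOrbit : ∀ {o a b} → AutRelated G o a → AutRelated G o b → AutRelated G a b
  sameOrbit oa ob = autRelated-trans (autRelated-sym oa) ob

  conjugate⇒autRelated : ∀ {x a} → Conjugate G a x → AutRelated G x a
  conjugate⇒autRelated (h , σhx≡a) = inner h , σhx≡a

  PairRelated : Elt G → Elt G → Set
  PairRelated a b = Σ (Aut G) λ φ → (Aut.fun φ a ≡ b) ⊎ (Aut.fun φ a ≡ inv b)

  pairRelated⇒orbit : ∀ {a b} → PairRelated a b →
    AutRelated G a b ⊎ AutRelated G (inv a) b
  pairRelated⇒orbit (φ , inj₁ φa≡b) = inj₁ (φ , φa≡b)
  pairRelated⇒orbit {a} {b} (φ , inj₂ φa≡b⁻¹) = inj₂ (φ , (begin
    Aut.fun φ (inv a)   ≡⟨ aut-inv φ a ⟩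
    inv (Aut.fun φ a)   ≡⟨ cong inv φa≡b⁻¹ ⟩
    inv (inv b)         ≡⟨ ⁻¹-involutive b ⟩
    b                   ∎))

  involution-self-inverse : ∀ {b} → HasOrder G b 2 → inv b ≡ b
  involution-self-inverse {b} (_ , b²≡e , _) =
    sym (inverseˡ-unique b b (trans (cong (b ∙_) (sym (idʳ b))) b²≡e))

  pairRelated-involution : ∀ {a b} → HasOrder G b 2 → PairRelated a b → AutRelated G a b
  pairRelated-involution _  (φ , inj₁ φa≡b)   = φ , φa≡b
  pairRelated-involution ob (φ , inj₂ φa≡b⁻¹) = φ , trans φa≡b⁻¹ (involution-self-inverse ob)

  Δ⊆Aut : ∀ {α δ} → InΔ G α δ → Σ (Aut G) λ φ → ∀ y → Aut.fun φ y ≡ δ y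
  Δ⊆Aut (h , γ , _ , δ≡σγ) = inner h ∘Aut γ , λ y → sym (δ≡σγ y)

  transitive⇒pairRelated : ∀ {x n} → TransitiveΩ* G x n →
    ∀ {a b} → InΩ* G x n a → InΩ* G x n b → PairRelated a b
  transitive⇒pairRelated T {a} {b} a∈Ω b∈Ω with T a b a∈Ω b∈Ω
  ... | δ , δ∈Δ , δa with Δ⊆Aut δ∈Δ
  ... | φ , φ≡δ with δa
  ...   | inj₁ δa≡b   = φ , inj₁ (trans (φ≡δ a) δa≡b)
  ...   | inj₂ δa≡b⁻¹ = φ , inj₂ (trans (φ≡δ a) δa≡b⁻¹)

  conjugate? : ∀ a x → Dec (Conjugate G a x)
  conjugate? a x = FinP.any? (λ h → σ G h x FinP.≟ a)

  twoOrbits-n≢2 : ∀ {x n} → n ≢ 2 → TransitiveΩ* G x n → AtMostTwoAutOrbits G n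
  twoOrbits-n≢2 {x} {n} n≢2 T a b c oa ob oc =
    pigeonhole (AutRelated G) (AutRelated G a) (AutRelated G (inv a))
      sameOrbit sameOrbit (orbit oa) (orbit ob) (orbit oc)
    where
      inΩ* : ∀ {u} → HasOrder G u n → InΩ* G x n u
      inΩ* ou = ou , λ n≡2 → ⊥-elim (n≢2 n≡2)

      orbit : ∀ {u} → HasOrder G u n → AutRelated G a u ⊎ AutRelated G (inv a) u
      orbit ou = pairRelated⇒orbit (transitive⇒pairRelated T (inΩ* oa) (inΩ* ou))

  twoOrbits-involutions : ∀ {x} → TransitiveΩ* G x 2 → AtMostTwoAutOrbits G 2
  twoOrbits-involutions {x} T a b c oa ob oc =
    pigeonhole (AutRelated G) (λ u → Conjugate G u x) (InΩ* G x 2)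
      (λ u~x v~x → sameOrbit (conjugate⇒autRelated u~x) (conjugate⇒autRelated v~x))
      (λ u∈Ω v∈Ω → pairRelated-involution (proj₁ v∈Ω) (transitive⇒pairRelated T u∈Ω v∈Ω))
      (classify oa) (classify ob) (classify oc)
    where
      classify : ∀ {u} → HasOrder G u 2 → Conjugate G u x ⊎ InΩ* G x 2 u
      classify {u} ou with conjugate? u x
      ... | yes u~x = inj₁ u~x
      ... | no u≁x  = inj₂ (ou , λ _ → u≁x)

-- Δ_α-transitivity on Ω*_x(G,n) confines the elements of order n to two
-- Aut(G)-orbits.
theorem3p1 : (G : FinGroup) → Nonabelian G → IsSimple G →
    (x : Elt G) → IsInvolution G x →
    (n : ℕ) → n ∣ FinGroup.order G →
    TransitiveΩ* G x n → AtMostTwoAutOrbits G n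
theorem3p1 G _ _ x _ n _ T with n ℕ.≟ 2
... | no n≢2   = twoOrbits-n≢2 G n≢2 T
... | yes refl = twoOrbits-involutions G T
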